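{- Define the map $H:\mathbb{Z}^2\to\mathbb{Z}^2$ by $$H((x,y))=\begin{cases}(y,\,-x+2y) & y\ge 0,\\ (y,\,-x+2y+1) & y<0.\end{cases}$$ For every $(x,y)\in\mathbb{Z}^2$ with $(x,y)\notin\{(m,m)\mid m=0,1,2,\dots\}$, the orbit $\{H^n((x,y)) : n\ge 0\}$ is unbounded.
   Context: $H$ is the map $(a_n,a_{n+1})\mapsto(a_{n+1},a_{n+2})$ for the sequence defined by $0\le a_{n+2}+(-2+0)a_{n+1}+a_n<1$, i.e. the limit as $\eta\to+0$ of $0\le a_{n+2}+(-2+\eta)a_{n+1}+a_n<1$; it is a bijection of $\mathbb{Z}^2$. -}

module Defs where

open import Data.Nat using (ℕ; zero; suc; _<_)
open import Data.Integer using (ℤ; +_; -[1+_]; _+_; _-_; -_; ∣_∣)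
open import Data.Product using (_×_; _,_; ∃)
open import Data.Sum using (_⊎_)

H : ℤ × ℤ → ℤ × ℤ
H (x , y@(+ _))     = (y , (- x + (y + y)))
H (x , y@(-[1+ _ ])) = (y , ((- x + (y + y)) + + 1))

H^ : ℕ → ℤ × ℤ → ℤ × ℤ
H^ zero    p = p
H^ (suc n) p = H (H^ n p)

OrbitUnbounded : ℤ × ℤ → Set
OrbitUnbounded p = ∀ (B : ℕ) → ∃ λ (n : ℕ) →
  let (a , b) = H^ n p in (B < ∣ a ∣) ⊎ (B < ∣ b ∣)

{-# OPTIONS --safe #-}
module Submission where

-- Write a point as (y , d) with y its second coordinate and d = y − x the last difference of
-- the sequence. Then H moves y by d while y ≥ 0, and while y < 0 it first increases d by one.
-- Hence once y ≥ 0 and d > 0 the sequence increases forever. Every other point, except the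
-- fixed points d = 0 ≤ y, gets there: for y ≥ 0 and d < 0, y decreases until it turns negative;
-- for y < 0 and d < 0, d climbs to 0 while y stays negative; for y < 0 and d ≥ 0, d keeps
-- increasing and y gains ever larger amounts until it becomes nonnegative.

open import Defs
open import Data.Nat as ℕ using (ℕ; zero; suc; _<_)
import Data.Nat.Properties as ℕ
open import Data.Nat.GeneralisedArithmetic using (fold; fold-+)
open import Data.Nat.Induction using (<-rec)
open import Data.Integer as ℤ using (ℤ; +_; -[1+_]; _+_; _-_; -_; ∣_∣; _⊖_; 0ℤ; 1ℤ)
open import Data.Integer.Properties
  using ([1+m]⊖[1+n]≡m⊖n; -1+m<n⊖m; m⊖1+n<m; drop‿-<-; drop‿+<+; +-identityʳ)
open import Data.Integer.Tactic.RingSolver using (solve-∀)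
open import Data.Product using (_×_; _,_; ∃; ∃-syntax; proj₁; proj₂)
open import Data.Sum using (_⊎_; inj₁; inj₂)
open import Data.Empty using (⊥-elim)
open import Relation.Binary.PropositionalEquality
  using (_≡_; refl; sym; trans; cong; subst; module ≡-Reasoning)
open import Relation.Nullary using (¬_)

n⊖m≡-[1+k]⇒k<m : ∀ {m n k} → n ⊖ m ≡ -[1+ k ] → k < m
n⊖m≡-[1+k]⇒k<m {m} {n} eq = drop‿-<- (subst (-[1+ m ] ℤ.<_) eq (-1+m<n⊖m m n))

m⊖[1+n]≡+k⇒k<m : ∀ {m n k} → m ⊖ suc n ≡ + k → k < m
m⊖[1+n]≡+k⇒k<m {m} {n} eq = drop‿+<+ (subst (ℤ._< + m) eq (m⊖1+n<m m (suc n)))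

fromDiff : ℤ × ℤ → ℤ × ℤ
fromDiff (y , d) = (y - d , y)

Hᵈ : ℤ × ℤ → ℤ × ℤ
Hᵈ (y@(+ _)      , d) = (y + d , d)
Hᵈ (y@(-[1+ _ ]) , d) = (y + (1ℤ + d) , 1ℤ + d)

fromDiff-advance : ∀ y e → fromDiff (y + e , e) ≡ (y , y + e)
fromDiff-advance y e = cong (_, y + e) (sym (y≡y+e-e y e))
  where
  y≡y+e-e : ∀ y e → y ≡ y + e - e
  y≡y+e-e = solve-∀

H∘fromDiff : ∀ p → H (fromDiff p) ≡ fromDiff (Hᵈ p)
H∘fromDiff (y@(+ _) , d) = trans (cong (y ,_) (next y d)) (sym (fromDiff-advance y d))
  where
  next : ∀ y d → - (y - d) + (y + y) ≡ y + d
  next = solve-∀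
H∘fromDiff (y@(-[1+ _ ]) , d) = trans (cong (y ,_) (next y d)) (sym (fromDiff-advance y (1ℤ + d)))
  where
  next : ∀ y d → - (y - d) + (y + y) + 1ℤ ≡ y + (1ℤ + d)
  next = solve-∀

H^∘fromDiff : ∀ n p → H^ n (fromDiff p) ≡ fromDiff (fold p Hᵈ n)
H^∘fromDiff zero    p = refl
H^∘fromDiff (suc n) p = trans (cong H (H^∘fromDiff n p)) (H∘fromDiff (fold p Hᵈ n))

fromDiff-inverse : ∀ x y → fromDiff (y , y - x) ≡ (x , y)
fromDiff-inverse x y = cong (_, y) (sym (x≡y-[y-x] x y))
  where
  x≡y-[y-x] : ∀ x y → x ≡ y - (y - x)
  x≡y-[y-x] = solve-∀

H^-second : ∀ n x y → proj₂ (H^ n (x , y)) ≡ proj₁ (fold (y , y - x) Hᵈ n)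
H^-second n x y = cong proj₂ (begin
  H^ n (x , y)                       ≡⟨ cong (H^ n) (fromDiff-inverse x y) ⟨
  H^ n (fromDiff (y , y - x))        ≡⟨ H^∘fromDiff n (y , y - x) ⟩
  fromDiff (fold (y , y - x) Hᵈ n)   ∎)
  where open ≡-Reasoning

fromDiff-fixed : ∀ {x y a} → (y , y - x) ≡ (+ a , 0ℤ) → (x , y) ≡ (+ a , + a)
fromDiff-fixed {x} {y} {a} eq = begin
  (x , y)                   ≡⟨ fromDiff-inverse x y ⟨
  fromDiff (y , y - x)      ≡⟨ cong fromDiff eq ⟩
  (+ a + 0ℤ , + a)          ≡⟨ cong (_, + a) (+-identityʳ (+ a)) ⟩
  (+ a , + a)               ∎
  where open ≡-Reasoning

Hᵈ^-nonnegative : ∀ a c n → fold (+ a , + c) Hᵈ n ≡ (+ (a ℕ.+ n ℕ.* c) , + c)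
Hᵈ^-nonnegative a c zero    = cong (λ a′ → (+ a′ , + c)) (sym (ℕ.+-identityʳ a))
Hᵈ^-nonnegative a c (suc n) = trans (cong Hᵈ (Hᵈ^-nonnegative a c n)) (cong (λ a′ → (+ a′ , + c)) (begin
  a ℕ.+ n ℕ.* c ℕ.+ c     ≡⟨ ℕ.+-assoc a (n ℕ.* c) c ⟩
  a ℕ.+ (n ℕ.* c ℕ.+ c)   ≡⟨ cong (a ℕ.+_) (ℕ.+-comm (n ℕ.* c) c) ⟩
  a ℕ.+ suc n ℕ.* c       ∎))
  where open ≡-Reasoning

data Ascending : ℤ × ℤ → Set where
  ascending : ∀ a k → Ascending (+ a , + suc k)

EventuallyAscending : ℤ × ℤ → Set
EventuallyAscending p = ∃[ n ] Ascending (fold p Hᵈ n)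

UnboundedPosition : ℤ × ℤ → Set
UnboundedPosition p = ∀ (B : ℕ) → ∃[ n ] B < ∣ proj₁ (fold p Hᵈ n) ∣

ascending⇒unboundedPosition : ∀ {p} → Ascending p → UnboundedPosition p
ascending⇒unboundedPosition (ascending a k) B =
  suc B , subst (λ q → B < ∣ proj₁ q ∣) (sym (Hᵈ^-nonnegative a (suc k) (suc B)))
                (ℕ.≤-trans (ℕ.m≤m*n (suc B) (suc k)) (ℕ.m≤n+m _ a))

eventuallyAscending⇒unboundedPosition : ∀ {p} → EventuallyAscending p → UnboundedPosition p
eventuallyAscending⇒unboundedPosition {p} (m , asc) B with ascending⇒unboundedPosition asc B
... | n , big = n ℕ.+ m , subst (λ q → B < ∣ proj₁ q ∣) (sym (fold-+ p Hᵈ n)) big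

eventuallyAscending-backwards : ∀ {p q} → Hᵈ p ≡ q → EventuallyAscending q → EventuallyAscending p
eventuallyAscending-backwards {p} refl (n , asc) = n ℕ.+ 1 , subst Ascending (sym (fold-+ p Hᵈ n)) asc

eventuallyAscending-−+ : ∀ b c → EventuallyAscending (-[1+ b ] , + c)
eventuallyAscending-−+ = <-rec _ climb
  where
  climb : ∀ b → (∀ {b′} → b′ < b → ∀ c → EventuallyAscending (-[1+ b′ ] , + c))
        → ∀ c → EventuallyAscending (-[1+ b ] , + c)
  climb b rec c =
    eventuallyAscending-backwards (cong (_, + suc c) ([1+m]⊖[1+n]≡m⊖n c b)) (next (c ⊖ b) refl)
    where
    next : ∀ y → c ⊖ b ≡ y → EventuallyAscending (y , + suc c)
    next (+ a)      _  = 0 , ascending a c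
    next -[1+ b′ ] eq = rec (n⊖m≡-[1+k]⇒k<m eq) (suc c)

eventuallyAscending-−− : ∀ b k → EventuallyAscending (-[1+ b ] , -[1+ k ])
eventuallyAscending-−− b zero    = eventuallyAscending-backwards refl (eventuallyAscending-−+ b 0)
eventuallyAscending-−− b (suc k) = eventuallyAscending-backwards refl (eventuallyAscending-−− (suc (b ℕ.+ k)) k)

eventuallyAscending-+− : ∀ a k → EventuallyAscending (+ a , -[1+ k ])
eventuallyAscending-+− = <-rec _ descend
  where
  descend : ∀ a → (∀ {a′} → a′ < a → ∀ k → EventuallyAscending (+ a′ , -[1+ k ]))
          → ∀ k → EventuallyAscending (+ a , -[1+ k ])
  descend a rec k = eventuallyAscending-backwards refl (next (a ⊖ suc k) refl)
    where
    next : ∀ y → a ⊖ suc k ≡ y → EventuallyAscending (y , -[1+ k ])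
    next (+ a′)     eq = rec (m⊖[1+n]≡+k⇒k<m eq) k
    next -[1+ b ] _  = eventuallyAscending-−− b k

eventuallyAscending-or-fixed : ∀ p → EventuallyAscending p ⊎ ∃[ a ] p ≡ (+ a , 0ℤ)
eventuallyAscending-or-fixed (+ a      , + zero)   = inj₂ (a , refl)
eventuallyAscending-or-fixed (+ a      , + suc k)  = inj₁ (0 , ascending a k)
eventuallyAscending-or-fixed (+ a      , -[1+ k ]) = inj₁ (eventuallyAscending-+− a k)
eventuallyAscending-or-fixed (-[1+ b ] , + c)      = inj₁ (eventuallyAscending-−+ b c)
eventuallyAscending-or-fixed (-[1+ b ] , -[1+ k ]) = inj₁ (eventuallyAscending-−− b k)

lemma1 : (x y : ℤ) → ¬ (∃ λ (m : ℕ) → (x , y) ≡ (+ m , + m)) → OrbitUnbounded (x , y)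
lemma1 x y notFixed B with eventuallyAscending-or-fixed (y , y - x)
... | inj₂ (a , eq) = ⊥-elim (notFixed (a , fromDiff-fixed eq))
... | inj₁ ea with eventuallyAscending⇒unboundedPosition ea B
...   | n , big = n , inj₂ (subst (B <_) (cong ∣_∣ (sym (H^-second n x y))) big)
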